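{- Let $w\in\mathcal{A}^*$ be a shortest period of the periodic word $\mathbf{u}=w^\omega$ (so $w$ contains every letter of $\mathcal{A}$), and suppose the language of $\mathbf{u}$ is closed under a non-erasing antimorphism $\Theta:\mathcal{A}^*\to\mathcal{A}^*$ of finite order. Then: (1) $\Theta$ is an involution; (2) $w=ps$ where $p$ and $s$ are $\Theta$-palindromes; (3) $\mathcal{P}_\Theta(n)+\mathcal{P}_\Theta(n+1)=2$ for every $n\ge|w|$.
   Context: An antimorphism on $\mathcal{A}^*$ satisfies $\Theta(vw)=\Theta(w)\Theta(v)$; it is non-erasing if $|\Theta(a)|>0$ for every letter $a$; finite order means $\Theta^k=\mathrm{Id}$ for some $k\ge1$ (composition in the monoid of morphisms and antimorphisms). A $\Theta$-palindrome is a word $v$ with $\Theta(v)=v$. The language of $\mathbf{u}$ is closed under $\Theta$ if $\Theta$ maps factors of $\mathbf{u}$ to factors of $\mathbf{u}$. $\mathcal{P}_\Theta(n)$ is the number of factors of $\mathbf{u}$ of length $n$ that are $\Theta$-palindromes. The alphabet $\mathcal{A}$ consists exactly of the letters occurring in $\mathbf{u}$. -}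

module Defs where

open import Data.Nat using (ℕ; zero; suc; _+_; _<_; _≤_)
open import Data.List using (List; []; _∷_; _++_; map; concat; reverse; upTo; length)
open import Data.List.Membership.Propositional using (_∈_)
open import Data.List.Relation.Unary.Unique.Propositional using (Unique)
open import Data.Product using (Σ; ∃; _×_; _,_)
open import Relation.Binary.PropositionalEquality using (_≡_; _≢_)
open import Relation.Nullary using (¬_)
open import Function.Bundles using (_⇔_)

module _ {A : Set} where

  -- The antimorphism Θ : A* → A* determined by the images θ a of the letters:
  -- Θ(a₁ a₂ … aₙ) = θ(aₙ) … θ(a₂) θ(a₁).  Every antimorphism is of this form.
  antimorph : (A → List A) → List A → List A
  antimorph θ v = concat (reverse (map θ v))

  NonErasing : (A → List A) → Set
  NonErasing θ = ∀ (a : A) → θ a ≢ []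

  _^[_] : (List A → List A) → ℕ → List A → List A
  (f ^[ zero ]) v = v
  (f ^[ suc k ]) v = f ((f ^[ k ]) v)

  FiniteOrder : (List A → List A) → Set
  FiniteOrder Θ = Σ ℕ λ k → (1 ≤ k) × (∀ v → (Θ ^[ k ]) v ≡ v)

  Involution : (List A → List A) → Set
  Involution Θ = ∀ v → Θ (Θ v) ≡ v

  IsPal : (List A → List A) → List A → Set
  IsPal Θ v = Θ v ≡ v

  factorAt : (ℕ → A) → ℕ → ℕ → List A
  factorAt u i n = map (λ j → u (i + j)) (upTo n)

  Factor : (ℕ → A) → List A → Set
  Factor u v = Σ ℕ λ i → v ≡ factorAt u i (length v)

  ClosedUnder : (ℕ → A) → (List A → List A) → Set
  ClosedUnder u Θ = ∀ v → Factor u v → Factor u (Θ v)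

  IsOmegaPower : (ℕ → A) → List A → Set
  IsOmegaPower u w = (factorAt u 0 (length w) ≡ w) × (∀ i → u (i + length w) ≡ u i)

  ShortestPeriod : (ℕ → A) → List A → Set
  ShortestPeriod u w =
    (w ≢ []) × IsOmegaPower u w ×
    (∀ q → 0 < q → q < length w → ¬ (∀ i → u (i + q) ≡ u i))

  -- PalCount u Θ n m :  𝓟_Θ(n) = m, i.e. the set of factors of u of length n
  -- which are Θ-palindromes has exactly m elements (listed without repetition).
  PalCount : (ℕ → A) → (List A → List A) → ℕ → ℕ → Set
  PalCount u Θ n m =
    Σ (List (List A)) λ L →
      Unique L × (∀ v → (v ∈ L) ⇔ (Factor u v × length v ≡ n × IsPal Θ v)) × length L ≡ m

-- Θ is non-erasing, so it never shortens a word, and since Θᵏ = Id it cannot lengthen one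
-- either: it sends letters to letters, Θ(v) = reverse (map τ v).  Closure of the language puts
-- Θ(w) at some position k of u, and since u is N-periodic (N = |w|) this makes u symmetric:
-- τ (u a) = u b whenever a + b + 1 ≡ s (mod N).  The symmetry gives τ ∘ τ = id on the letters
-- of w, which are all letters.  A factor of length n ≥ N at position i is a Θ-palindrome
-- exactly when 2i + n ≡ s, because a second centre of symmetry would give a period smaller
-- than N; splitting w after s mod N letters gives its two palindromes.  The N factors of
-- length n ≥ N are pairwise distinct, so 𝓟_Θ(n) + 𝓟_Θ(n+1) counts the j < 2N with
-- j + n ≡ s (j = 2i or 2i + 1), and every residue occurs exactly twice among them.
module Submission where

open import Defs
open import Data.Empty using (⊥-elim)
open import Data.List
  using (List; []; _∷_; _++_; map; concat; reverse; applyUpTo; applyDownFrom; upTo; filter; length)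
open import Data.List.Membership.Propositional using (_∈_)
open import Data.List.Membership.Propositional.Properties
  using (∈-map⁺; ∈-map⁻; ∈-filter⁺; ∈-filter⁻; ∈-upTo⁺)
open import Data.List.Properties
  using (∷-injective; unfold-reverse; concat-++; ++-identityʳ; length-++; length-map; length-reverse;
         length-applyUpTo; map-applyUpTo; map-upTo; map-cong; map-∘; map-id; reverse-applyUpTo; reverse-map;
         reverse-involutive)
import Data.List.Relation.Unary.AllPairs.Properties as AllPairs
open import Data.List.Relation.Unary.Unique.Propositional using (Unique)
open import Data.Nat
  using (ℕ; zero; suc; pred; _+_; _*_; _∸_; _<_; _≤_; z≤n; s≤s; z<s; NonZero; _≟_; _%_; _/_)
open import Data.Nat.Divisibility using (_∣_; divides)
open import Data.Nat.DivMod
  using (m≡m%n+[m/n]*n; %-distribˡ-+; %-remove-+ˡ; m%n%n≡m%n; [m+n]%n≡m%n; m%n<n; m<n⇒m%n≡m)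
open import Data.Nat.ListAction using (sum)
open import Data.Nat.ListAction.Properties using (sum-++)
open import Data.Nat.Properties
  using (+-assoc; +-comm; +-suc; +-identityʳ; *-comm; suc-pred; suc-injective; 0≢1+n;
         ≤-refl; ≤-trans; ≤-reflexive; ≤-pred; <⇒≤; <-≤-trans; ≤-<-trans; +-mono-≤; m≤m+n;
         m+[n∸m]≡n; m<n⇒0<n∸m; m∸n≤m; +-commutativeSemigroup)
open import Algebra.Properties.CommutativeSemigroup +-commutativeSemigroup
  using (x∙yz≈y∙xz; x∙yz≈xz∙y; x∙yz≈yx∙z; xy∙z≈xz∙y; interchange)
open import Data.Product using (Σ; _×_; _,_; proj₁; proj₂)
open import Function using (_∘_; id)
open import Function.Bundles using (_⇔_; mk⇔; Equivalence)
open import Relation.Nullary using (Dec; yes; no; ¬_)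
open import Relation.Unary using (Decidable)
open import Relation.Binary.PropositionalEquality
  using (_≡_; _≢_; refl; sym; trans; cong; cong₂; subst; subst₂; module ≡-Reasoning)

open ≡-Reasoning

infix 4 _≡_mod_
_≡_mod_ : ℕ → ℕ → (d : ℕ) → .{{NonZero d}} → Set
_≡_mod_ m n d = m % d ≡ n % d

module _ {d : ℕ} .{{_ : NonZero d}} where

  +-cong-mod : ∀ {a b c e} → a ≡ b mod d → c ≡ e mod d → a + c ≡ b + e mod d
  +-cong-mod {a} {b} {c} {e} a≡b c≡e = begin
    (a + c) % d          ≡⟨ %-distribˡ-+ a c d ⟩
    (a % d + c % d) % d  ≡⟨ cong₂ (λ x y → (x + y) % d) a≡b c≡e ⟩
    (b % d + e % d) % d  ≡⟨ %-distribˡ-+ b e d ⟨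
    (b + e) % d          ∎

  suc-cong-mod : ∀ {a b} → a ≡ b mod d → suc a ≡ suc b mod d
  suc-cong-mod {a} {b} = +-cong-mod {1} {1} {a} {b} refl

  d∣pred[d]*c+c : ∀ c → d ∣ pred d * c + c
  d∣pred[d]*c+c c = divides c (begin
    pred d * c + c    ≡⟨ +-comm (pred d * c) c ⟩
    suc (pred d) * c  ≡⟨ cong (_* c) (suc-pred d) ⟩
    d * c             ≡⟨ *-comm d c ⟩
    c * d             ∎)

  private
    +-inverseˡ-mod : ∀ c a → pred d * c + (c + a) ≡ a mod d
    +-inverseˡ-mod c a = trans (cong (_% d) (sym (+-assoc (pred d * c) c a))) (%-remove-+ˡ a (d∣pred[d]*c+c c))

  +-cancelˡ-mod : ∀ c {a b} → c + a ≡ c + b mod d → a ≡ b mod d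
  +-cancelˡ-mod c {a} {b} h =
    trans (sym (+-inverseˡ-mod c a)) (trans (+-cong-mod {pred d * c} refl h) (+-inverseˡ-mod c b))

  solve-mod : ∀ c a → Σ ℕ λ x → x < d × c + x ≡ a mod d
  solve-mod c a = x , m%n<n (pred d * c + a) d , (begin
      (c + x) % d                 ≡⟨ +-cong-mod {c} refl (m%n%n≡m%n (pred d * c + a) d) ⟩
      (c + (pred d * c + a)) % d  ≡⟨ cong (_% d) (x∙yz≈y∙xz c (pred d * c) a) ⟩
      (pred d * c + (c + a)) % d  ≡⟨ +-inverseˡ-mod c a ⟩
      a % d                       ∎)
    where x = (pred d * c + a) % d

  mod-injective-< : ∀ {a b} → a < d → b < d → a ≡ b mod d → a ≡ b
  mod-injective-< a<d b<d a≡b = trans (sym (m<n⇒m%n≡m a<d)) (trans a≡b (m<n⇒m%n≡m b<d))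

module _ {A : Set} where

  applyUpTo-cong : ∀ {f g : ℕ → A} → (∀ i → f i ≡ g i) → ∀ n → applyUpTo f n ≡ applyUpTo g n
  applyUpTo-cong f≗g zero    = refl
  applyUpTo-cong f≗g (suc n) = cong₂ _∷_ (f≗g 0) (applyUpTo-cong (f≗g ∘ suc) n)

  applyUpTo-++ : ∀ (f : ℕ → A) m n → applyUpTo f (m + n) ≡ applyUpTo f m ++ applyUpTo (λ j → f (m + j)) n
  applyUpTo-++ f zero    n = refl
  applyUpTo-++ f (suc m) n = cong (f 0 ∷_) (applyUpTo-++ (f ∘ suc) m n)

indicator : {P : Set} → Dec P → ℕ
indicator (yes _) = 1
indicator (no _)  = 0

module _ {A : Set} {P : A → Set} (P? : Decidable P) where

  length-filter-applyUpTo : ∀ (f : ℕ → A) n →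
    length (filter P? (applyUpTo f n)) ≡ sum (applyUpTo (λ i → indicator (P? (f i))) n)
  length-filter-applyUpTo f zero = refl
  length-filter-applyUpTo f (suc n) with P? (f 0)
  ... | yes _ = cong suc (length-filter-applyUpTo (f ∘ suc) n)
  ... | no _  = length-filter-applyUpTo (f ∘ suc) n

sum-applyUpTo-+ : ∀ (f : ℕ → ℕ) m n →
  sum (applyUpTo f (m + n)) ≡ sum (applyUpTo f m) + sum (applyUpTo (λ j → f (m + j)) n)
sum-applyUpTo-+ f m n = trans (cong sum (applyUpTo-++ f m n)) (sum-++ (applyUpTo f m) _)

sum-applyUpTo-even+odd : ∀ (f : ℕ → ℕ) m →
  sum (applyUpTo (λ i → f (i + i)) m) + sum (applyUpTo (λ i → f (suc (i + i))) m) ≡ sum (applyUpTo f (m + m))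
sum-applyUpTo-even+odd f zero    = refl
sum-applyUpTo-even+odd f (suc m) = begin
  (f 0 + sum (applyUpTo (λ i → f (suc i + suc i)) m)) + (f 1 + sum (applyUpTo (λ i → f (suc (suc i + suc i))) m))
    ≡⟨ cong₂ (λ x y → (f 0 + x) + (f 1 + y))
         (cong sum (applyUpTo-cong (λ i → cong (f ∘ suc) (+-suc i i)) m))
         (cong sum (applyUpTo-cong (λ i → cong (f ∘ suc ∘ suc) (+-suc i i)) m)) ⟩
  (f 0 + sum (applyUpTo (λ i → g (i + i)) m)) + (f 1 + sum (applyUpTo (λ i → g (suc (i + i))) m))
    ≡⟨ interchange (f 0) _ (f 1) _ ⟩
  (f 0 + f 1) + (sum (applyUpTo (λ i → g (i + i)) m) + sum (applyUpTo (λ i → g (suc (i + i))) m))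
    ≡⟨ cong (f 0 + f 1 +_) (sum-applyUpTo-even+odd g m) ⟩
  (f 0 + f 1) + sum (applyUpTo g (m + m))
    ≡⟨ +-assoc (f 0) (f 1) _ ⟩
  f 0 + (f 1 + sum (applyUpTo g (m + m)))
    ≡⟨ cong (λ k → f 0 + sum (applyUpTo (f ∘ suc) k)) (+-suc m m) ⟨
  sum (applyUpTo f (suc m + suc m)) ∎
  where g = f ∘ suc ∘ suc

sum-indicator-none : ∀ {P : ℕ → Set} (P? : Decidable P) → ∀ {n} → (∀ {i} → i < n → ¬ P i) →
  sum (applyUpTo (λ i → indicator (P? i)) n) ≡ 0
sum-indicator-none P? {zero}  none = refl
sum-indicator-none P? {suc n} none with P? 0
... | yes p0 = ⊥-elim (none z<s p0)
... | no _   = sum-indicator-none (P? ∘ suc) (none ∘ s≤s)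

sum-indicator-unique : ∀ {P : ℕ → Set} (P? : Decidable P) → ∀ {n j} → j < n → P j →
  (∀ {i} → i < n → P i → i ≡ j) → sum (applyUpTo (λ i → indicator (P? i)) n) ≡ 1
sum-indicator-unique P? {suc n} {j} j<n pj unique with P? 0
... | yes p0 = cong suc (sum-indicator-none (P? ∘ suc)
                 (λ i<n p → 0≢1+n (trans (unique z<s p0) (sym (unique (s≤s i<n) p)))))
sum-indicator-unique P? {suc n} {zero}  j<n   pj unique | no ¬p0 = ⊥-elim (¬p0 pj)
sum-indicator-unique P? {suc n} {suc j} 1+j<n pj unique | no _ =
  sum-indicator-unique (P? ∘ suc) (≤-pred 1+j<n) pj (λ i<n p → suc-injective (unique (s≤s i<n) p))

module _ (d : ℕ) .{{_ : NonZero d}} where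

  sum-indicator-residue : ∀ c s → sum (applyUpTo (λ j → indicator ((j + c) % d ≟ s % d)) d) ≡ 1
  sum-indicator-residue c s with x , x<d , c+x≡s ← solve-mod c s =
    sum-indicator-unique (λ j → (j + c) % d ≟ s % d) x<d (trans (cong (_% d) (+-comm x c)) c+x≡s)
      λ {i} i<d i+c≡s → mod-injective-< i<d x<d
        (+-cancelˡ-mod c (trans (cong (_% d) (+-comm c i)) (trans i+c≡s (sym c+x≡s))))

  centred : ℕ → ℕ → List ℕ
  centred s n = filter (λ i → (i + i + n) % d ≟ s % d) (upTo d)

  length-centred+length-centred-suc : ∀ s n → length (centred s n) + length (centred s (n + 1)) ≡ 2
  length-centred+length-centred-suc s n = begin
    length (centred s n) + length (centred s (n + 1))
      ≡⟨ cong₂ _+_ (length-filter-applyUpTo _ id d) (length-filter-applyUpTo _ id d) ⟩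
    sum (applyUpTo (λ i → χ (i + i + n)) d) + sum (applyUpTo (λ i → χ (i + i + (n + 1))) d)
      ≡⟨ cong (λ xs → sum (applyUpTo (λ i → χ (i + i + n)) d) + sum xs)
              (applyUpTo-cong (λ i → cong χ (trans (cong (i + i +_) (+-comm n 1)) (+-suc (i + i) n))) d) ⟩
    sum (applyUpTo (λ i → χ (i + i + n)) d) + sum (applyUpTo (λ i → χ (suc (i + i) + n)) d)
      ≡⟨ sum-applyUpTo-even+odd (λ j → χ (j + n)) d ⟩
    sum (applyUpTo (λ j → χ (j + n)) (d + d))
      ≡⟨ sum-applyUpTo-+ (λ j → χ (j + n)) d d ⟩
    sum (applyUpTo (λ j → χ (j + n)) d) + sum (applyUpTo (λ j → χ (d + j + n)) d)
      ≡⟨ cong (sum (applyUpTo (λ j → χ (j + n)) d) +_)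
              (cong sum (applyUpTo-cong (λ j → cong χ (trans (+-assoc d j n) (x∙yz≈y∙xz d j n))) d)) ⟩
    sum (applyUpTo (λ j → χ (j + n)) d) + sum (applyUpTo (λ j → χ (j + (d + n))) d)
      ≡⟨ cong₂ _+_ (sum-indicator-residue n s) (sum-indicator-residue (d + n) s) ⟩
    2 ∎
    where
      χ : ℕ → ℕ
      χ m = indicator (m % d ≟ s % d)

module _ {A : Set} where

  ^[suc]-shift : (f : List A → List A) → ∀ m v → (f ^[ suc m ]) v ≡ (f ^[ m ]) (f v)
  ^[suc]-shift f zero    v = refl
  ^[suc]-shift f (suc m) v = cong f (^[suc]-shift f m v)

  letterwise-involution : ∀ {Θ : List A → List A} (τ : A → A) → (∀ v → Θ v ≡ reverse (map τ v)) →
                          (∀ a → τ (τ a) ≡ a) → Involution Θ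
  letterwise-involution {Θ} τ Θ-letterwise ττ≗id v = begin
    Θ (Θ v)                              ≡⟨ Θ-letterwise (Θ v) ⟩
    reverse (map τ (Θ v))                ≡⟨ cong (reverse ∘ map τ) (Θ-letterwise v) ⟩
    reverse (map τ (reverse (map τ v)))  ≡⟨ cong reverse (reverse-map τ (map τ v)) ⟩
    reverse (reverse (map τ (map τ v)))  ≡⟨ reverse-involutive _ ⟩
    map τ (map τ v)                      ≡⟨ map-∘ v ⟨
    map (τ ∘ τ) v                        ≡⟨ map-cong ττ≗id v ⟩
    map id v                             ≡⟨ map-id v ⟩
    v                                    ∎

  applyUpTo-injective-< : ∀ {f g : ℕ → A} n → applyUpTo f n ≡ applyUpTo g n →
                          ∀ {t} → t < n → f t ≡ g t
  applyUpTo-injective-< (suc n) f≡g {zero}  _           = proj₁ (∷-injective f≡g)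
  applyUpTo-injective-< (suc n) f≡g {suc t} (s≤s t<n) =
    applyUpTo-injective-< n (proj₂ (∷-injective f≡g)) t<n

  applyDownFrom≡applyUpTo⇔ : ∀ (f g : ℕ → A) n →
    applyDownFrom f n ≡ applyUpTo g n ⇔ (∀ x y → suc (x + y) ≡ n → f x ≡ g y)
  applyDownFrom≡applyUpTo⇔ f g zero = mk⇔ (λ _ _ _ ()) (λ _ → refl)
  applyDownFrom≡applyUpTo⇔ f g (suc n) = mk⇔ to from
    where
      module IH = Equivalence (applyDownFrom≡applyUpTo⇔ f (g ∘ suc) n)
      to : applyDownFrom f (suc n) ≡ applyUpTo g (suc n) → ∀ x y → suc (x + y) ≡ suc n → f x ≡ g y
      to fn∷D≡g0∷U x zero    x+0≡n = trans (cong f (trans (sym (+-identityʳ x)) (cong pred x+0≡n)))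
                                            (proj₁ (∷-injective fn∷D≡g0∷U))
      to fn∷D≡g0∷U x (suc y) e    = IH.to (proj₂ (∷-injective fn∷D≡g0∷U)) x y
                                      (trans (sym (+-suc x y)) (cong pred e))
      from : (∀ x y → suc (x + y) ≡ suc n → f x ≡ g y) → applyDownFrom f (suc n) ≡ applyUpTo g (suc n)
      from h = cong₂ _∷_ (h n 0 (cong suc (+-identityʳ n)))
                         (IH.from (λ x y e → h x (suc y) (cong suc (trans (+-suc x y) e))))

module _ {A : Set} (θ : A → List A) where

  antimorph-∷ : ∀ a v → antimorph θ (a ∷ v) ≡ antimorph θ v ++ θ a
  antimorph-∷ a v = begin
    concat (reverse (θ a ∷ map θ v))           ≡⟨ cong concat (unfold-reverse (θ a) (map θ v)) ⟩
    concat (reverse (map θ v) ++ θ a ∷ [])     ≡⟨ concat-++ (reverse (map θ v)) (θ a ∷ []) ⟨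
    antimorph θ v ++ θ a ++ []                 ≡⟨ cong (antimorph θ v ++_) (++-identityʳ (θ a)) ⟩
    antimorph θ v ++ θ a                       ∎

  length-antimorph : NonErasing θ → ∀ v → length v ≤ length (antimorph θ v)
  length-antimorph nonErasing []      = z≤n
  length-antimorph nonErasing (a ∷ v) =
    ≤-trans (+-mono-≤ (1≤length (nonErasing a)) (length-antimorph nonErasing v)) (≤-reflexive (begin
      length (θ a) + length (antimorph θ v)  ≡⟨ +-comm (length (θ a)) _ ⟩
      length (antimorph θ v) + length (θ a)  ≡⟨ length-++ (antimorph θ v) ⟨
      length (antimorph θ v ++ θ a)          ≡⟨ cong length (antimorph-∷ a v) ⟨
      length (antimorph θ (a ∷ v))           ∎))
    where
      1≤length : ∀ {l : List A} → l ≢ [] → 1 ≤ length l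
      1≤length {[]}    l≢[] = ⊥-elim (l≢[] refl)
      1≤length {_ ∷ _} _    = s≤s z≤n

  length-antimorph-^ : NonErasing θ → ∀ m v → length v ≤ length ((antimorph θ ^[ m ]) v)
  length-antimorph-^ nonErasing zero    v = ≤-refl
  length-antimorph-^ nonErasing (suc m) v =
    ≤-trans (length-antimorph-^ nonErasing m v) (length-antimorph nonErasing ((antimorph θ ^[ m ]) v))

  letter-to-letter : NonErasing θ → FiniteOrder (antimorph θ) → ∀ a → Σ A λ b → θ a ≡ b ∷ []
  letter-to-letter nonErasing (suc m , _ , Θ^k≗id) a = singleton (θ a) (nonErasing a) length-θa≤1
    where
      Θ = antimorph θ
      length-θa≤1 : length (θ a) ≤ 1
      length-θa≤1 = subst₂ _≤_ (cong length (antimorph-∷ a [])) (cong length Θ^[m]Θa≡a)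
                      (length-antimorph-^ nonErasing m (Θ (a ∷ [])))
        where
          Θ^[m]Θa≡a : (Θ ^[ m ]) (Θ (a ∷ [])) ≡ a ∷ []
          Θ^[m]Θa≡a = trans (sym (^[suc]-shift Θ m (a ∷ []))) (Θ^k≗id (a ∷ []))
      singleton : (l : List A) → l ≢ [] → length l ≤ 1 → Σ A λ b → l ≡ b ∷ []
      singleton []          l≢[] _ = ⊥-elim (l≢[] refl)
      singleton (b ∷ [])    _    _ = b , refl
      singleton (_ ∷ _ ∷ _) _    (s≤s ())

  antimorph-letterwise : (τ : A → A) → (∀ a → θ a ≡ τ a ∷ []) →
                         ∀ v → antimorph θ v ≡ reverse (map τ v)
  antimorph-letterwise τ θ≡τ []      = refl
  antimorph-letterwise τ θ≡τ (a ∷ v) = begin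
    antimorph θ (a ∷ v)               ≡⟨ antimorph-∷ a v ⟩
    antimorph θ v ++ θ a              ≡⟨ cong₂ _++_ (antimorph-letterwise τ θ≡τ v) (θ≡τ a) ⟩
    reverse (map τ v) ++ τ a ∷ []     ≡⟨ unfold-reverse (τ a) (map τ v) ⟨
    reverse (map τ (a ∷ v))           ∎

suc-interchange : ∀ a x b y → suc (a + x + (b + y)) ≡ a + b + suc (x + y)
suc-interchange a x b y = trans (cong suc (interchange a x b y)) (sym (+-suc (a + b) (x + y)))

module _ {A : Set} (u : ℕ → A) where

  factorAt-applyUpTo : ∀ i n → factorAt u i n ≡ applyUpTo (λ j → u (i + j)) n
  factorAt-applyUpTo i n = map-upTo (λ j → u (i + j)) n

  length-factorAt : ∀ i n → length (factorAt u i n) ≡ n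
  length-factorAt i n = trans (cong length (factorAt-applyUpTo i n)) (length-applyUpTo _ n)

  factorAt-++ : ∀ i m n → factorAt u i (m + n) ≡ factorAt u i m ++ factorAt u (i + m) n
  factorAt-++ i m n = begin
    factorAt u i (m + n)
      ≡⟨ factorAt-applyUpTo i (m + n) ⟩
    applyUpTo (λ j → u (i + j)) (m + n)
      ≡⟨ applyUpTo-++ (λ j → u (i + j)) m n ⟩
    applyUpTo (λ j → u (i + j)) m ++ applyUpTo (λ j → u (i + (m + j))) n
      ≡⟨ cong₂ _++_ (factorAt-applyUpTo i m) (trans (factorAt-applyUpTo (i + m) n)
                                                          (applyUpTo-cong (λ j → cong u (+-assoc i m j)) n)) ⟨
    factorAt u i m ++ factorAt u (i + m) n ∎

  module _ (τ : A → A) where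

    Reflection : ℕ → ℕ → ℕ → Set
    Reflection a b n = ∀ x y → suc (x + y) ≡ n → τ (u (a + x)) ≡ u (b + y)

    reverse-map-factorAt≡factorAt⇔Reflection : ∀ a b n →
      reverse (map τ (factorAt u a n)) ≡ factorAt u b n ⇔ Reflection a b n
    reverse-map-factorAt≡factorAt⇔Reflection a b n =
      mk⇔ (λ e → to (trans (sym lhs) (trans e rhs))) (λ r → trans lhs (trans (from r) (sym rhs)))
      where
        open Equivalence (applyDownFrom≡applyUpTo⇔ (λ x → τ (u (a + x))) (λ y → u (b + y)) n)
        lhs : reverse (map τ (factorAt u a n)) ≡ applyDownFrom (λ x → τ (u (a + x))) n
        lhs = begin
          reverse (map τ (factorAt u a n))
            ≡⟨ cong (reverse ∘ map τ) (factorAt-applyUpTo a n) ⟩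
          reverse (map τ (applyUpTo (λ x → u (a + x)) n))
            ≡⟨ cong reverse (map-applyUpTo _ τ n) ⟩
          reverse (applyUpTo (λ x → τ (u (a + x))) n)
            ≡⟨ reverse-applyUpTo _ n ⟩
          applyDownFrom (λ x → τ (u (a + x))) n ∎
        rhs : factorAt u b n ≡ applyUpTo (λ y → u (b + y)) n
        rhs = factorAt-applyUpTo b n

module Periodic {A : Set} (u : ℕ → A) (N : ℕ) .{{_ : NonZero N}} (period : ∀ i → u (i + N) ≡ u i) where

  NoSmallerPeriod : Set
  NoSmallerPeriod = ∀ q → 0 < q → q < N → ¬ (∀ i → u (i + q) ≡ u i)

  u-+*N : ∀ r k → u (r + k * N) ≡ u r
  u-+*N r zero    = cong u (+-identityʳ r)
  u-+*N r (suc k) = begin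
    u (r + (N + k * N))  ≡⟨ cong u (x∙yz≈xz∙y r N (k * N)) ⟩
    u (r + k * N + N)    ≡⟨ period (r + k * N) ⟩
    u (r + k * N)        ≡⟨ u-+*N r k ⟩
    u r                  ∎

  u-mod : ∀ {i j} → i ≡ j mod N → u i ≡ u j
  u-mod {i} {j} i≡j = trans (u-% i) (trans (cong u i≡j) (sym (u-% j)))
    where
      u-% : ∀ i → u i ≡ u (i % N)
      u-% i = trans (cong u (m≡m%n+[m/n]*n i N)) (u-+*N (i % N) (i / N))

  factorAt-mod : ∀ {i j} → i ≡ j mod N → ∀ n → factorAt u i n ≡ factorAt u j n
  factorAt-mod i≡j n = map-cong (λ k → u-mod (+-cong-mod i≡j refl)) (upTo n)

  factorAt-distinct : NoSmallerPeriod → ∀ {n i j} → N ≤ n → i < j → j < N →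
                      factorAt u i n ≢ factorAt u j n
  factorAt-distinct noSmaller {n} {i} {j} N≤n i<j j<N same =
    noSmaller (j ∸ i) (m<n⇒0<n∸m i<j) (≤-<-trans (m∸n≤m j i) j<N) period-j∸i
    where
      same-< : ∀ {t} → t < n → u (i + t) ≡ u (j + t)
      same-< = applyUpTo-injective-< n
                 (trans (sym (factorAt-applyUpTo u i n)) (trans same (factorAt-applyUpTo u j n)))
      period-j∸i : ∀ t → u (t + (j ∸ i)) ≡ u t
      period-j∸i t with t′ , t′<N , i+t′≡t ← solve-mod i t = begin
        u (t + (j ∸ i))       ≡⟨ u-mod (+-cong-mod (sym i+t′≡t) refl) ⟩
        u (i + t′ + (j ∸ i))  ≡⟨ cong u (xy∙z≈xz∙y i t′ (j ∸ i)) ⟩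
        u (i + (j ∸ i) + t′)  ≡⟨ cong (λ k → u (k + t′)) (m+[n∸m]≡n (<⇒≤ i<j)) ⟩
        u (j + t′)            ≡⟨ same-< (<-≤-trans t′<N N≤n) ⟨
        u (i + t′)            ≡⟨ u-mod i+t′≡t ⟩
        u t                   ∎

  module Mirrors (τ : A → A) where

    -- Reflection of u in the point (s − 1)/2, followed by τ; positions are read modulo N.
    Mirror : ℕ → Set
    Mirror s = ∀ a b → suc (a + b) ≡ s mod N → τ (u a) ≡ u b

    mirror-swap : ∀ {s} → Mirror s → ∀ {a b} → suc (a + b) ≡ s mod N → τ (u b) ≡ u a
    mirror-swap mirror {a} {b} h = mirror b a (trans (cong (λ k → suc k % N) (+-comm b a)) h)

    mirror-of-reflection : ∀ {a₀ b₀ n} → N ≤ n → Reflection u τ a₀ b₀ n → Mirror (a₀ + b₀ + n)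
    mirror-of-reflection {a₀} {b₀} {n} N≤n reflection a b h
      with x , x<N , a₀+x≡a ← solve-mod a₀ a = begin
        τ (u a)         ≡⟨ cong τ (u-mod a₀+x≡a) ⟨
        τ (u (a₀ + x))  ≡⟨ reflection x y 1+x+y≡n ⟩
        u (b₀ + y)      ≡⟨ u-mod b₀+y≡b ⟩
        u b             ∎
      where
        y = n ∸ suc x
        1+x+y≡n : suc (x + y) ≡ n
        1+x+y≡n = m+[n∸m]≡n (<-≤-trans x<N N≤n)
        b₀+y≡b : b₀ + y ≡ b mod N
        b₀+y≡b = +-cancelˡ-mod (suc a) (begin
          (suc a + (b₀ + y)) % N
            ≡⟨ +-cong-mod {a = suc a} {b = suc (a₀ + x)} (suc-cong-mod (sym a₀+x≡a)) refl ⟩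
          (suc (a₀ + x) + (b₀ + y)) % N
            ≡⟨ cong (_% N) (trans (suc-interchange a₀ x b₀ y) (cong (a₀ + b₀ +_) 1+x+y≡n)) ⟩
          (a₀ + b₀ + n) % N
            ≡⟨ h ⟨
          (suc a + b) % N ∎)

    reflection-of-mirror : ∀ {s a₀ b₀ n} → Mirror s → a₀ + b₀ + n ≡ s mod N →
                           Reflection u τ a₀ b₀ n
    reflection-of-mirror {a₀ = a₀} {b₀} mirror h x y 1+x+y≡n =
      mirror (a₀ + x) (b₀ + y)
        (trans (cong (_% N) (trans (suc-interchange a₀ x b₀ y) (cong (a₀ + b₀ +_) 1+x+y≡n))) h)

    mirror-involutive : ∀ {s} → Mirror s → ∀ t → τ (τ (u t)) ≡ u t
    mirror-involutive {s} mirror t with a , _ , 1+t+a≡s ← solve-mod (suc t) s =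
      trans (cong τ (mirror t a 1+t+a≡s)) (mirror-swap mirror 1+t+a≡s)

    mirror-unique : NoSmallerPeriod → ∀ {s s′} → Mirror s → Mirror s′ → s ≡ s′ mod N
    mirror-unique noSmaller {s} {s′} mirror mirror′ with solve-mod s s′
    ... | zero  , _   , s+0≡s′ = trans (cong (_% N) (sym (+-identityʳ s))) s+0≡s′
    ... | suc d , d<N , s+d≡s′ = ⊥-elim (noSmaller (suc d) z<s d<N period-d)
      where
        period-d : ∀ t → u (t + suc d) ≡ u t
        period-d t with a , _ , 1+t+a≡s ← solve-mod (suc t) s =
          trans (sym (mirror′ a (t + suc d) 1+a+t+d≡s′)) (mirror-swap mirror 1+t+a≡s)
          where
            1+a+t+d≡s′ : suc (a + (t + suc d)) ≡ s′ mod N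
            1+a+t+d≡s′ = trans (cong (λ k → suc k % N) (x∙yz≈yx∙z a t (suc d)))
                               (trans (+-cong-mod 1+t+a≡s refl) s+d≡s′)

    module Palindromes (Θ : List A → List A) (Θ-letterwise : ∀ v → Θ v ≡ reverse (map τ v)) where

      Θ-factorAt⇔Reflection : ∀ a b n → Θ (factorAt u a n) ≡ factorAt u b n ⇔ Reflection u τ a b n
      Θ-factorAt⇔Reflection a b n = mk⇔ (to ∘ trans (sym (Θ-letterwise _))) (trans (Θ-letterwise _) ∘ from)
        where open Equivalence (reverse-map-factorAt≡factorAt⇔Reflection u τ a b n)

      centred⇒palindrome : ∀ {s i n} → Mirror s → i + i + n ≡ s mod N → IsPal Θ (factorAt u i n)
      centred⇒palindrome {i = i} {n} mirror h =
        Equivalence.from (Θ-factorAt⇔Reflection i i n) (reflection-of-mirror mirror h)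

      palindrome⇒centred : NoSmallerPeriod → ∀ {s i n} → Mirror s → N ≤ n →
                           IsPal Θ (factorAt u i n) → i + i + n ≡ s mod N
      palindrome⇒centred noSmaller {i = i} {n} mirror N≤n pal =
        mirror-unique noSmaller
          (mirror-of-reflection N≤n (Equivalence.to (Θ-factorAt⇔Reflection i i n) pal)) mirror

      palCount : NoSmallerPeriod → ∀ {s} → Mirror s → ∀ {n} → N ≤ n →
                 PalCount u Θ n (length (centred N s n))
      palCount noSmaller {s} mirror {n} N≤n =
        palindromes , distinct , (λ v → mk⇔ (sound v) (complete v)) , length-map _ (centred N s n)
        where
          palindromes : List (List A)
          palindromes = map (λ i → factorAt u i n) (centred N s n)
          distinct : Unique palindromes
          distinct = AllPairs.map⁺ (AllPairs.filter⁺ _ (AllPairs.applyUpTo⁺₁ id N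
                       (λ i<j j<N → factorAt-distinct noSmaller N≤n i<j j<N)))
          sound : ∀ v → v ∈ palindromes → Factor u v × length v ≡ n × IsPal Θ v
          sound v v∈palindromes with i , i∈centred , refl ← ∈-map⁻ _ v∈palindromes =
            (i , cong (factorAt u i) (sym (length-factorAt u i n))) ,
            length-factorAt u i n ,
            centred⇒palindrome mirror
              (proj₂ (∈-filter⁻ (λ i → (i + i + n) % N ≟ s % N) {xs = upTo N} i∈centred))
          complete : ∀ v → Factor u v × length v ≡ n × IsPal Θ v → v ∈ palindromes
          complete v ((j , v≡factor) , |v|≡n , pal) =
            subst (_∈ palindromes) (sym v≡factor′)
              (∈-map⁺ _ (∈-filter⁺ _ (∈-upTo⁺ (m%n<n j N))
                (palindrome⇒centred noSmaller mirror N≤n (subst (IsPal Θ) v≡factor′ pal))))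
            where
              v≡factor′ : v ≡ factorAt u (j % N) n
              v≡factor′ = trans v≡factor
                (trans (cong (factorAt u j) |v|≡n) (factorAt-mod (sym (m%n%n≡m%n j N)) n))

      palindromic-factorisation : ∀ {s} → Mirror s →
        Σ (List A) λ p → Σ (List A) λ q → (factorAt u 0 N ≡ p ++ q) × IsPal Θ p × IsPal Θ q
      palindromic-factorisation {s} mirror =
        factorAt u 0 c , factorAt u c (N ∸ c) ,
        trans (cong (factorAt u 0) (sym c+[N∸c]≡N)) (factorAt-++ u 0 c (N ∸ c)) ,
        centred⇒palindrome mirror (m%n%n≡m%n s N) ,
        centred⇒palindrome mirror (begin
          (c + c + (N ∸ c)) % N  ≡⟨ cong (_% N) (trans (+-assoc c c (N ∸ c)) (cong (c +_) c+[N∸c]≡N)) ⟩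
          (c + N) % N            ≡⟨ [m+n]%n≡m%n c N ⟩
          c % N                  ≡⟨ m%n%n≡m%n s N ⟩
          s % N                  ∎)
        where
          c = s % N
          c+[N∸c]≡N : c + (N ∸ c) ≡ N
          c+[N∸c]≡N = m+[n∸m]≡n (<⇒≤ (m%n<n s N))

      mirror-of-closure : ClosedUnder u Θ → Σ ℕ Mirror
      mirror-of-closure closed
        with k , Θw≡factor ← closed (factorAt u 0 N) (0 , cong (factorAt u 0) (sym (length-factorAt u 0 N))) =
        0 + k + N , mirror-of-reflection ≤-refl
          (Equivalence.to (Θ-factorAt⇔Reflection 0 k N) (trans Θw≡factor (cong (factorAt u k) |Θw|≡N)))
        where
          |Θw|≡N : length (Θ (factorAt u 0 N)) ≡ N
          |Θw|≡N = begin
            length (Θ (factorAt u 0 N))                ≡⟨ cong length (Θ-letterwise _) ⟩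
            length (reverse (map τ (factorAt u 0 N)))  ≡⟨ length-reverse (map τ (factorAt u 0 N)) ⟩
            length (map τ (factorAt u 0 N))            ≡⟨ length-map τ (factorAt u 0 N) ⟩
            length (factorAt u 0 N)                    ≡⟨ length-factorAt u 0 N ⟩
            N                                          ∎

      letters-involutive : ∀ {s} → Mirror s → (∀ a → a ∈ factorAt u 0 N) → ∀ a → τ (τ a) ≡ a
      letters-involutive mirror occurs a with j , _ , refl ← ∈-map⁻ _ (occurs a) =
        mirror-involutive mirror (0 + j)

proposition5 : {A : Set} (u : ℕ → A) (w : List A) (θ : A → List A) →
    ShortestPeriod u w →
    (∀ (a : A) → a ∈ w) →
    NonErasing θ →
    FiniteOrder (antimorph θ) →
    ClosedUnder u (antimorph θ) →
    Involution (antimorph θ) ×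
    (Σ (List A) λ p → Σ (List A) λ s →
        (w ≡ p ++ s) × IsPal (antimorph θ) p × IsPal (antimorph θ) s) ×
    (∀ n → length w ≤ n →
        Σ ℕ λ a → Σ ℕ λ b →
          PalCount u (antimorph θ) n a × PalCount u (antimorph θ) (n + 1) b × (a + b ≡ 2))
proposition5 u []        θ (w≢[] , _) _ _ _ _ = ⊥-elim (w≢[] refl)
proposition5 {A} u w@(_ ∷ _) θ (_ , (w-prefix , period) , noSmallerPeriod)
             every-letter nonErasing finiteOrder closed =
  letterwise-involution τ Θ-letterwise
    (letters-involutive {s} mirror (λ a → subst (a ∈_) (sym w-prefix) (every-letter a))) ,
  subst (λ v → Σ (List A) λ p → Σ (List A) λ q → (v ≡ p ++ q) × IsPal Θ p × IsPal Θ q)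
    w-prefix (palindromic-factorisation {s} mirror) ,
  λ n |w|≤n → _ , _ ,
    palCount noSmallerPeriod {s} mirror |w|≤n ,
    palCount noSmallerPeriod {s} mirror (≤-trans |w|≤n (m≤m+n n 1)) ,
    length-centred+length-centred-suc (length w) s n
  where
    Θ : List A → List A
    Θ = antimorph θ
    τ : A → A
    τ a = proj₁ (letter-to-letter θ nonErasing finiteOrder a)
    Θ-letterwise : ∀ v → Θ v ≡ reverse (map τ v)
    Θ-letterwise = antimorph-letterwise θ τ (proj₂ ∘ letter-to-letter θ nonErasing finiteOrder)
    open Periodic u (length w) period
    open Mirrors τ
    open Palindromes Θ Θ-letterwise
    s : ℕ
    s = proj₁ (mirror-of-closure closed)
    mirror : Mirror s
    mirror = proj₂ (mirror-of-closure closed)
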